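{- Let $k\in\mathbb{Z}$, let $a\in\mathbb{C}$ with $a\neq 0$, and let $n\ge 0$. Then \[ PC_{n}^{(k)}(x:a)=\sum_{l=0}^{n}\binom{n}{l}\frac{(-1)^{n-l}}{a^{l}}\,C_{l}^{(k)}(x). \]
   Context: For an integer $k$, $\mathrm{Lif}_k(t)=\sum_{n=0}^{\infty}\frac{t^{n}}{n!\,(n+1)^{k}}$ (a formal power series). The poly-Cauchy polynomials of the first kind $C_n^{(k)}(x)$ are defined by $\frac{1}{(1+t)^{x}}\mathrm{Lif}_k(\log(1+t))=\sum_{n\ge0}C_n^{(k)}(x)\frac{t^n}{n!}$. For $a\neq0$, the Poisson-Charlier and poly-Cauchy of the first kind mixed type polynomials $PC_n^{(k)}(x:a)$ are defined by $e^{ -t}\,\mathrm{Lif}_k\!\left(\log\left(1+\frac{t}{a}\right)\right)\left(1+\frac{t}{a}\right)^{ -x}=\sum_{n\ge0}PC_n^{(k)}(x:a)\frac{t^n}{n!}$. -}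

module Defs where

open import Level using (Level)
open import Data.Nat as ℕ using (ℕ; zero; suc; _∸_)
open import Data.Nat.Combinatorics using (_C_)
open import Data.Integer as ℤ using (ℤ; +_; -[1+_])
open import Data.Rational as ℚ using (ℚ)
open import Data.Rational.Properties using (+-*-commutativeRing)
open import Algebra.Bundles using (CommutativeRing)
open import Algebra.Morphism.Structures using (module RingMorphisms)

recipSuc : ℕ → ℚ
recipSuc n = (+ 1) ℚ./ (suc n)

invFact : ℕ → ℚ
invFact zero    = ℚ.1ℚ
invFact (suc n) = invFact n ℚ.* recipSuc n

natℚ : ℕ → ℚ
natℚ n = (+ n) ℚ./ 1

-- A ℚ-algebra: a commutative ring R with a unital ring homomorphism ℚ → R.
-- (ℂ, with the inclusion ℚ ⊆ ℂ, is an instance.)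
IsℚAlgebraMap : ∀ {c ℓ} (R : CommutativeRing c ℓ) → (ℚ → CommutativeRing.Carrier R) → Set ℓ
IsℚAlgebraMap R ι =
  RingMorphisms.IsRingHomomorphism
    (CommutativeRing.rawRing +-*-commutativeRing) (CommutativeRing.rawRing R) ι

module _ {c ℓ} (R : CommutativeRing c ℓ) (ι : ℚ → CommutativeRing.Carrier R) where
  open CommutativeRing R

  PS : Set c
  PS = ℕ → Carrier

  pw : Carrier → ℕ → Carrier
  pw u zero    = 1#
  pw u (suc m) = u * pw u m

  sumTo : (ℕ → Carrier) → ℕ → Carrier
  sumTo f zero    = f 0
  sumTo f (suc n) = sumTo f n + f (suc n)

  psMul : PS → PS → PS
  psMul f g n = sumTo (λ i → f i * g (n ∸ i)) n

  psOne : PS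
  psOne zero    = 1#
  psOne (suc _) = 0#

  psPow : PS → ℕ → PS
  psPow f zero    = psOne
  psPow f (suc m) = psMul f (psPow f m)

  -- composition F(G(t)) for G with zero constant term:
  -- [t^n] F(G(t)) = Σ_{m=0}^{n} F_m [t^n] G(t)^m
  psComp : PS → PS → PS
  psComp F G n = sumTo (λ m → F m * psPow G m n) n

  -- substitution t ↦ u t :  f(u t)
  psScale : Carrier → PS → PS
  psScale u f n = pw u n * f n

  -- log(1+t) = Σ_{n≥1} (-1)^{n-1} t^n / n
  psLog1p : PS
  psLog1p zero    = 0#
  psLog1p (suc n) = pw (- 1#) n * ι (recipSuc n)

  psExpNeg : PS
  psExpNeg n = pw (- 1#) n * ι (invFact n)

  -- binomial series (1+t)^y = Σ_n y(y-1)...(y-n+1)/n! t^n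
  fallingFact : Carrier → ℕ → Carrier
  fallingFact y zero    = 1#
  fallingFact y (suc n) = fallingFact y n * (y - ι (natℚ n))

  psBinom : Carrier → PS
  psBinom y n = ι (invFact n) * fallingFact y n

  -- Lif_k(t) = Σ_n t^n / (n! (n+1)^k),  k ∈ ℤ
  psLif : ℤ → PS
  psLif (+ m)      n = ι (invFact n) * pw (ι (recipSuc n)) m
  psLif -[1+ m ]   n = ι (invFact n) * pw (ι (natℚ (suc n))) (suc m)

  factR : ℕ → Carrier
  factR n = ι (natℚ (n ℕ.!))

  -- poly-Cauchy polynomials of the first kind, evaluated at x:
  -- (1+t)^{-x} Lif_k(log(1+t)) = Σ C_n^{(k)}(x) t^n / n!
  polyCauchy : ℤ → ℕ → Carrier → Carrier
  polyCauchy k n x = factR n * psMul (psBinom (- x)) (psComp (psLif k) psLog1p) n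

  -- Poisson–Charlier / poly-Cauchy mixed type, with ainv = 1/a:
  -- e^{-t} Lif_k(log(1+t/a)) (1+t/a)^{-x} = Σ PC_n^{(k)}(x:a) t^n / n!
  PCpoly : ℤ → ℕ → Carrier → Carrier → Carrier
  PCpoly k n x ainv =
    factR n * psMul psExpNeg
                    (psMul (psComp (psLif k) (psScale ainv psLog1p))
                           (psScale ainv (psBinom (- x)))) n

  binomR : ℕ → ℕ → Carrier
  binomR n l = ι (natℚ (n C l))

-- PC_n is n! times the n-th coefficient of e^{-t} G(t/a), where G(t) = (1+t)^{-x} Lif_k(log(1+t))
-- is the generating function of the C_l/l!.  Substituting t ↦ t/a commutes with products and
-- compositions (it multiplies the n-th coefficient by a^{-n}), so the claim is the Cauchy product of
-- e^{-t} = Σ (-1)^m t^m/m! with Σ a^{-l} C_l t^l/l!, read through n!/((n-l)! l!) = C(n,l).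
module Submission where

open import Defs
open import Data.Nat using (ℕ; _∸_)
open import Data.Integer using (ℤ)
open import Data.Rational using (ℚ)
open import Algebra.Bundles using (CommutativeRing)

open import Data.Nat as ℕ using (zero; suc; _≤_; z≤n; _!)
open import Data.Nat.Combinatorics using (_C_; nCk≡n!/k![n-k]!; k![n∸k]!∣n!)
open import Data.Nat.DivMod using (m/n*n≡m)
import Data.Nat.Properties as ℕ
open import Data.Integer as ℤ using (+_)
import Data.Integer.Properties as ℤ
import Data.Rational.Properties as ℚ
open import Data.Rational.Unnormalised as ℚᵘ using (mkℚᵘ; _≃_; *≡*)
import Data.Rational.Unnormalised.Properties as ℚᵘ
open import Algebra.Morphism.Structures using (module RingMorphisms)
open import Data.Maybe using (nothing)
open import Relation.Binary.PropositionalEquality as ≡ using (_≡_)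
open import Tactic.RingSolver using (solve-∀)
open import Tactic.RingSolver.Core.AlmostCommutativeRing using (AlmostCommutativeRing; fromCommutativeRing)
import Relation.Binary.Reasoning.Setoid as ≈-Reasoning

module _ where
  open Data.Rational using (_*_; 1ℚ; toℚᵘ)
  open ≡ using (refl; trans; cong; cong₂; module ≡-Reasoning)

  private
    ℚ-ring : AlmostCommutativeRing _ _
    ℚ-ring = fromCommutativeRing ℚ.+-*-commutativeRing (λ _ → nothing)

  toℚᵘ-natℚ : ∀ n → toℚᵘ (natℚ n) ≃ mkℚᵘ (+ n) 0
  toℚᵘ-natℚ n = ℚ.toℚᵘ-fromℚᵘ (mkℚᵘ (+ n) 0)

  natℚ-homo-* : ∀ m n → natℚ (m ℕ.* n) ≡ natℚ m * natℚ n
  natℚ-homo-* m n = ℚ.toℚᵘ-injective (begin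
    toℚᵘ (natℚ (m ℕ.* n))                  ≈⟨ toℚᵘ-natℚ (m ℕ.* n) ⟩
    mkℚᵘ (+ (m ℕ.* n)) 0                   ≈⟨ *≡* (cong (ℤ._* + 1) (ℤ.pos-* m n)) ⟩
    mkℚᵘ (+ m) 0 ℚᵘ.* mkℚᵘ (+ n) 0         ≈⟨ ℚᵘ.*-cong (toℚᵘ-natℚ m) (toℚᵘ-natℚ n) ⟨
    toℚᵘ (natℚ m) ℚᵘ.* toℚᵘ (natℚ n)       ≈⟨ ℚ.toℚᵘ-homo-* (natℚ m) (natℚ n) ⟨
    toℚᵘ (natℚ m * natℚ n)                 ∎)
    where open ℚᵘ.≃-Reasoning

  natℚ-suc-*-recipSuc : ∀ n → natℚ (suc n) * recipSuc n ≡ 1ℚ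
  natℚ-suc-*-recipSuc n = ℚ.toℚᵘ-injective (begin
    toℚᵘ (natℚ (suc n) * recipSuc n)                  ≈⟨ ℚ.toℚᵘ-homo-* (natℚ (suc n)) (recipSuc n) ⟩
    toℚᵘ (natℚ (suc n)) ℚᵘ.* toℚᵘ (recipSuc n)        ≈⟨ ℚᵘ.*-cong (toℚᵘ-natℚ (suc n)) (ℚ.toℚᵘ-fromℚᵘ (mkℚᵘ (+ 1) n)) ⟩
    mkℚᵘ (+ suc n) 0 ℚᵘ.* mkℚᵘ (+ 1) n                ≈⟨ ℚᵘ.*-inverseʳ (mkℚᵘ (+ suc n) 0) ⟩
    ℚᵘ.1ℚᵘ                                            ∎)
    where open ℚᵘ.≃-Reasoning

  invFact-*-fact : ∀ n → invFact n * natℚ (n !) ≡ 1ℚ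
  invFact-*-fact zero    = refl
  invFact-*-fact (suc n) = begin
    invFact n * recipSuc n * natℚ (suc n ℕ.* n !)              ≡⟨ cong (invFact n * recipSuc n *_) (natℚ-homo-* (suc n) (n !)) ⟩
    invFact n * recipSuc n * (natℚ (suc n) * natℚ (n !))       ≡⟨ regroup (invFact n) (recipSuc n) (natℚ (suc n)) (natℚ (n !)) ⟩
    invFact n * natℚ (n !) * (natℚ (suc n) * recipSuc n)       ≡⟨ cong₂ _*_ (invFact-*-fact n) (natℚ-suc-*-recipSuc n) ⟩
    1ℚ                                                         ∎
    where
    open ≡-Reasoning
    regroup : ∀ a b c d → a * b * (c * d) ≡ a * d * (c * b)
    regroup = solve-∀ ℚ-ring

  nCk*k!*[n∸k]!≡n! : ∀ {n k} → k ≤ n → (n C k) ℕ.* (k ! ℕ.* (n ∸ k) !) ≡ n !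
  nCk*k!*[n∸k]!≡n! {n} {k} k≤n = begin
    (n C k) ℕ.* (k ! ℕ.* (n ∸ k) !)                       ≡⟨ cong (ℕ._* (k ! ℕ.* (n ∸ k) !)) (nCk≡n!/k![n-k]! k≤n) ⟩
    n ! ℕ./ (k ! ℕ.* (n ∸ k) !) ℕ.* (k ! ℕ.* (n ∸ k) !)   ≡⟨ m/n*n≡m (k![n∸k]!∣n! k≤n) ⟩
    n !                                                   ∎
    where
    open ≡-Reasoning
    instance _ = ℕ._!*_!≢0 k (n ∸ k)

  n!*invFact[n∸k]≡nCk*k! : ∀ {n k} → k ≤ n → natℚ (n !) * invFact (n ∸ k) ≡ natℚ (n C k) * natℚ (k !)
  n!*invFact[n∸k]≡nCk*k! {n} {k} k≤n = begin
    natℚ (n !) * I                               ≡⟨ cong (λ m → natℚ m * I) (nCk*k!*[n∸k]!≡n! k≤n) ⟨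
    natℚ ((n C k) ℕ.* (k ! ℕ.* (n ∸ k) !)) * I   ≡⟨ cong (_* I) natℚ-split ⟩
    natℚ (n C k) * (natℚ (k !) * natℚ ((n ∸ k) !)) * I
                                                 ≡⟨ regroup (natℚ (n C k)) (natℚ (k !)) (natℚ ((n ∸ k) !)) I ⟩
    natℚ (n C k) * natℚ (k !) * (I * natℚ ((n ∸ k) !))
                                                 ≡⟨ cong (natℚ (n C k) * natℚ (k !) *_) (invFact-*-fact (n ∸ k)) ⟩
    natℚ (n C k) * natℚ (k !) * 1ℚ               ≡⟨ ℚ.*-identityʳ _ ⟩
    natℚ (n C k) * natℚ (k !)                    ∎
    where
    open ≡-Reasoning
    I : ℚ
    I = invFact (n ∸ k)
    natℚ-split : natℚ ((n C k) ℕ.* (k ! ℕ.* (n ∸ k) !)) ≡ natℚ (n C k) * (natℚ (k !) * natℚ ((n ∸ k) !))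
    natℚ-split = trans (natℚ-homo-* (n C k) _) (cong (natℚ (n C k) *_) (natℚ-homo-* (k !) ((n ∸ k) !)))
    regroup : ∀ a b c d → a * (b * c) * d ≡ a * b * (d * c)
    regroup = solve-∀ ℚ-ring

module FormalPowerSeries {c ℓ} (R : CommutativeRing c ℓ) (ι : ℚ → CommutativeRing.Carrier R) where
  open CommutativeRing R
  open ≈-Reasoning setoid
  open import Algebra.Properties.CommutativeSemigroup *-commutativeSemigroup using (interchange; x∙yz≈y∙xz; xy∙z≈x∙zy)

  private
    Σ≤ : (ℕ → Carrier) → ℕ → Carrier
    Σ≤ = sumTo R ι

    _^_ : Carrier → ℕ → Carrier
    _^_ = pw R ι

    _⋆_ : PS R ι → PS R ι → PS R ι
    _⋆_ = psMul R ι

    scale : Carrier → PS R ι → PS R ι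
    scale = psScale R ι

  sumTo-cong : ∀ {f g} n → (∀ i → i ≤ n → f i ≈ g i) → Σ≤ f n ≈ Σ≤ g n
  sumTo-cong zero    f≈g = f≈g 0 z≤n
  sumTo-cong (suc n) f≈g =
    +-cong (sumTo-cong n (λ i i≤n → f≈g i (ℕ.m≤n⇒m≤1+n i≤n))) (f≈g (suc n) ℕ.≤-refl)

  *-distribˡ-sumTo : ∀ a f n → a * Σ≤ f n ≈ Σ≤ (λ i → a * f i) n
  *-distribˡ-sumTo a f zero    = refl
  *-distribˡ-sumTo a f (suc n) = trans (distribˡ a (Σ≤ f n) (f (suc n))) (+-congʳ (*-distribˡ-sumTo a f n))

  sumTo-suc : ∀ f n → Σ≤ f (suc n) ≈ f 0 + Σ≤ (λ i → f (suc i)) n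
  sumTo-suc f zero    = refl
  sumTo-suc f (suc n) = trans (+-congʳ (sumTo-suc f n)) (+-assoc _ _ _)

  sumTo-reverse : ∀ f n → Σ≤ f n ≈ Σ≤ (λ i → f (n ∸ i)) n
  sumTo-reverse f zero    = refl
  sumTo-reverse f (suc n) = begin
    Σ≤ f n + f (suc n)                       ≈⟨ +-congʳ (sumTo-reverse f n) ⟩
    Σ≤ (λ i → f (n ∸ i)) n + f (suc n)       ≈⟨ +-comm _ _ ⟩
    f (suc n) + Σ≤ (λ i → f (n ∸ i)) n       ≈⟨ sumTo-suc (λ i → f (suc n ∸ i)) n ⟨
    Σ≤ (λ i → f (suc n ∸ i)) (suc n)         ∎

  pw-homo-+ : ∀ u i j → u ^ (i ℕ.+ j) ≈ u ^ i * u ^ j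
  pw-homo-+ u zero    j = sym (*-identityˡ _)
  pw-homo-+ u (suc i) j = trans (*-congˡ (pw-homo-+ u i j)) (sym (*-assoc u (u ^ i) (u ^ j)))

  pw-split : ∀ u {i n} → i ≤ n → u ^ i * u ^ (n ∸ i) ≈ u ^ n
  pw-split u {i} {n} i≤n = trans (sym (pw-homo-+ u i (n ∸ i))) (reflexive (≡.cong (u ^_) (ℕ.m+[n∸m]≡n i≤n)))

  psMul-cong : ∀ {f f′ g g′} → (∀ i → f i ≈ f′ i) → (∀ j → g j ≈ g′ j) → ∀ n → (f ⋆ g) n ≈ (f′ ⋆ g′) n
  psMul-cong f≈f′ g≈g′ n = sumTo-cong n (λ i _ → *-cong (f≈f′ i) (g≈g′ (n ∸ i)))

  psMul-comm : ∀ f g n → (f ⋆ g) n ≈ (g ⋆ f) n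
  psMul-comm f g n = trans (sumTo-reverse _ n) (sumTo-cong n λ i i≤n →
    trans (*-congˡ (reflexive (≡.cong g (ℕ.m∸[m∸n]≡n i≤n)))) (*-comm _ _))

  psScale-psMul : ∀ u f g n → (scale u f ⋆ scale u g) n ≈ scale u (f ⋆ g) n
  psScale-psMul u f g n = begin
    Σ≤ (λ i → (u ^ i * f i) * (u ^ (n ∸ i) * g (n ∸ i))) n  ≈⟨ sumTo-cong n (λ i i≤n → trans (interchange _ _ _ _) (*-congʳ (pw-split u i≤n))) ⟩
    Σ≤ (λ i → u ^ n * (f i * g (n ∸ i))) n                 ≈⟨ *-distribˡ-sumTo (u ^ n) _ n ⟨
    u ^ n * (f ⋆ g) n                                      ∎

  psScale-psOne : ∀ u n → scale u (psOne R ι) n ≈ psOne R ι n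
  psScale-psOne u zero    = *-identityʳ 1#
  psScale-psOne u (suc n) = zeroʳ _

  psPow-psScale : ∀ u G m n → psPow R ι (scale u G) m n ≈ scale u (psPow R ι G m) n
  psPow-psScale u G zero    n = sym (psScale-psOne u n)
  psPow-psScale u G (suc m) n =
    trans (psMul-cong (λ _ → refl) (psPow-psScale u G m) n) (psScale-psMul u G (psPow R ι G m) n)

  psComp-psScaleʳ : ∀ u F G n → psComp R ι F (scale u G) n ≈ scale u (psComp R ι F G) n
  psComp-psScaleʳ u F G n = begin
    Σ≤ (λ m → F m * psPow R ι (scale u G) m n) n        ≈⟨ sumTo-cong n (λ m _ → trans (*-congˡ (psPow-psScale u G m n)) (x∙yz≈y∙xz _ _ _)) ⟩
    Σ≤ (λ m → u ^ n * (F m * psPow R ι G m n)) n         ≈⟨ *-distribˡ-sumTo (u ^ n) _ n ⟨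
    u ^ n * psComp R ι F G n                             ∎

  module _ (ι-hom : IsℚAlgebraMap R ι) where
    open RingMorphisms.IsRingHomomorphism ι-hom using (*-homo)

    factR-*-psExpNeg : ∀ {n l} → l ≤ n →
      factR R ι n * psExpNeg R ι (n ∸ l) ≈ binomR R ι n l * ((- 1#) ^ (n ∸ l) * factR R ι l)
    factR-*-psExpNeg {n} {l} l≤n = begin
      factR R ι n * ((- 1#) ^ (n ∸ l) * ι (invFact (n ∸ l)))    ≈⟨ x∙yz≈y∙xz _ _ _ ⟩
      (- 1#) ^ (n ∸ l) * (factR R ι n * ι (invFact (n ∸ l)))    ≈⟨ *-congˡ factR-*-invFact ⟩
      (- 1#) ^ (n ∸ l) * (binomR R ι n l * factR R ι l)         ≈⟨ x∙yz≈y∙xz _ _ _ ⟩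
      binomR R ι n l * ((- 1#) ^ (n ∸ l) * factR R ι l)         ∎
      where
      factR-*-invFact : factR R ι n * ι (invFact (n ∸ l)) ≈ binomR R ι n l * factR R ι l
      factR-*-invFact =
        trans (sym (*-homo _ _)) (trans (reflexive (≡.cong ι (n!*invFact[n∸k]≡nCk*k! l≤n))) (*-homo _ _))

    PCpoly-binomial-expansion : ∀ k u x n → PCpoly R ι k n x u ≈
      Σ≤ (λ l → binomR R ι n l * ((- 1#) ^ (n ∸ l) * (u ^ l * polyCauchy R ι k l x))) n
    PCpoly-binomial-expansion k u x n = begin
      factR R ι n * (E ⋆ M) n                                  ≈⟨ *-congˡ (psMul-cong (λ _ → refl) M≈scale[u]H n) ⟩
      factR R ι n * (E ⋆ scale u H) n                          ≈⟨ *-congˡ (psMul-comm E (scale u H) n) ⟩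
      factR R ι n * (scale u H ⋆ E) n                          ≈⟨ *-distribˡ-sumTo (factR R ι n) _ n ⟩
      Σ≤ (λ l → factR R ι n * ((u ^ l * H l) * E (n ∸ l))) n   ≈⟨ sumTo-cong n summand ⟩
      Σ≤ (λ l → binomR R ι n l * ((- 1#) ^ (n ∸ l) * (u ^ l * polyCauchy R ι k l x))) n ∎
      where
      E B F L H M : PS R ι
      E = psExpNeg R ι
      B = psBinom R ι (- x)
      F = psLif R ι k
      L = psLog1p R ι
      H = B ⋆ psComp R ι F L
      M = psComp R ι F (scale u L) ⋆ scale u B

      M≈scale[u]H : ∀ j → M j ≈ scale u H j
      M≈scale[u]H j = begin
        (psComp R ι F (scale u L) ⋆ scale u B) j   ≈⟨ psMul-cong {g = scale u B} (psComp-psScaleʳ u F L) (λ _ → refl) j ⟩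
        (scale u (psComp R ι F L) ⋆ scale u B) j   ≈⟨ psScale-psMul u (psComp R ι F L) B j ⟩
        u ^ j * (psComp R ι F L ⋆ B) j             ≈⟨ *-congˡ (psMul-comm (psComp R ι F L) B j) ⟩
        u ^ j * H j                                ∎

      rearrange : ∀ p h b s f → (p * h) * (b * (s * f)) ≈ b * (s * (p * (f * h)))
      rearrange p h b s f =
        trans (x∙yz≈y∙xz _ _ _) (*-congˡ (trans (x∙yz≈y∙xz _ _ _) (*-congˡ (xy∙z≈x∙zy p h f))))

      summand : ∀ l → l ≤ n → factR R ι n * ((u ^ l * H l) * E (n ∸ l)) ≈
                           binomR R ι n l * ((- 1#) ^ (n ∸ l) * (u ^ l * polyCauchy R ι k l x))
      summand l l≤n = trans (x∙yz≈y∙xz _ _ _) (trans (*-congˡ (factR-*-psExpNeg l≤n)) (rearrange _ _ _ _ _))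

theorem1 : ∀ {c ℓ} (R : CommutativeRing c ℓ) (ι : ℚ → CommutativeRing.Carrier R)
    → IsℚAlgebraMap R ι
    → (k : ℤ) (a ainv x : CommutativeRing.Carrier R)
    → CommutativeRing._≈_ R (CommutativeRing._*_ R a ainv) (CommutativeRing.1# R)
    → (n : ℕ)
    → CommutativeRing._≈_ R (PCpoly R ι k n x ainv)
        (sumTo R ι (λ l → CommutativeRing._*_ R (binomR R ι n l)
                            (CommutativeRing._*_ R (pw R ι (CommutativeRing.-_ R (CommutativeRing.1# R)) (n ∸ l))
                              (CommutativeRing._*_ R (pw R ι ainv l) (polyCauchy R ι k l x)))) n)
theorem1 R ι ι-hom k _ ainv x _ n = FormalPowerSeries.PCpoly-binomial-expansion R ι ι-hom k ainv x n
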